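{- Let $\mathbf{L}=\langle L,\leq,\otimes,\rightarrow,0,1\rangle$ be a complete residuated lattice, ${}^*$ an idempotent truth-stressing hedge on $\mathbf{L}$, and $S=\{\langle f_{a^*},h_{a^*}\rangle;\ a\in L\}$, where $f_c(x)=c\otimes x$ and $h_c(x)=c\rightarrow x$ for $x\in L$. Define $\rightsquigarrow$ on $S$ by $$\langle f_{a^*},h_{a^*}\rangle\rightsquigarrow\langle f_{b^*},h_{b^*}\rangle=\bigvee\{\langle f_{c^*},h_{c^*}\rangle;\ a^*\otimes c^*\leq b^*,\ c\in L\}$$ (supremum with respect to $\leqslant$). Then $\langle S,\leqslant,\circ,\rightsquigarrow,\langle f_\bot,h_\bot\rangle,\langle\mathrm{id},\mathrm{id}\rangle\rangle$ is a complete commutative integral residuated lattice.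
   Context: A complete (commutative integral) residuated lattice: a complete lattice with least element (here $0$ / $\langle f_\bot,h_\bot\rangle$) and greatest element (here $1$ / $\langle\mathrm{id},\mathrm{id}\rangle$), with an associative commutative multiplication whose neutral element is the greatest element, and a residuum satisfying $x\otimes y\leq z$ iff $y\leq x\rightarrow z$. An idempotent truth-stressing hedge is ${}^*\colon L\to L$ with $1^*=1$, $a^*\leq a$, $(a\rightarrow b)^*\leq a^*\rightarrow b^*$, $a^{**}=a^*$. Isotone Galois connections in $\langle L,\leq\rangle$ are pairs $\langle f,h\rangle$ with $f(a)\leq b$ iff $a\leq h(b)$; composition $\langle f_1,h_1\rangle\circ\langle f_2,h_2\rangle=\langle f_1f_2,h_2h_1\rangle$; $\langle f_1,h_1\rangle\leqslant\langle f_2,h_2\rangle$ iff $f_1(a)\leq f_2(a)$ for all $a\in L$. $f_\bot(a)=0$ and $h_\bot(a)=1$ for all $a\in L$. -}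

module Defs where

open import Level using (Level; suc)
open import Data.Product using (Σ; ∃; _×_; _,_)
open import Relation.Binary.Core using (Rel)
open import Relation.Binary.Structures using (IsPartialOrder)
open import Relation.Binary.PropositionalEquality using (_≡_; refl)
open import Algebra.Structures using (IsCommutativeMonoid)

IsLub : ∀ {ℓ} {A : Set ℓ} → Rel A ℓ → (A → Set ℓ) → A → Set ℓ
IsLub {A = A} _≤_ P u =
  (∀ x → P x → x ≤ u) × (∀ v → (∀ x → P x → x ≤ v) → u ≤ v)

record IsCompleteResiduatedLattice {ℓ} {A : Set ℓ}
         (_≈_ : Rel A ℓ) (_≤_ : Rel A ℓ)
         (_⊗_ : A → A → A) (_⇒_ : A → A → A) (𝟘 𝟙 : A) : Set (suc ℓ) where
  field
    isPartialOrder      : IsPartialOrder _≈_ _≤_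
    ⋁                   : (A → Set ℓ) → A
    ⋁-isLub             : ∀ P → IsLub _≤_ P (⋁ P)
    𝟘-least             : ∀ x → 𝟘 ≤ x
    𝟙-greatest          : ∀ x → x ≤ 𝟙
    isCommutativeMonoid : IsCommutativeMonoid _≈_ _⊗_ 𝟙
    residuation₁        : ∀ x y z → (x ⊗ y) ≤ z → y ≤ (x ⇒ z)
    residuation₂        : ∀ x y z → y ≤ (x ⇒ z) → (x ⊗ y) ≤ z

record CompleteResiduatedLattice ℓ : Set (suc ℓ) where
  field
    Carrier : Set ℓ
    _≤_     : Rel Carrier ℓ
    _⊗_     : Carrier → Carrier → Carrier
    _⇒_     : Carrier → Carrier → Carrier
    𝟘 𝟙     : Carrier
    isCompleteResiduatedLattice :
      IsCompleteResiduatedLattice _≡_ _≤_ _⊗_ _⇒_ 𝟘 𝟙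
  open IsCompleteResiduatedLattice isCompleteResiduatedLattice public

record IsHedge {ℓ} (L : CompleteResiduatedLattice ℓ)
         (_* : CompleteResiduatedLattice.Carrier L →
               CompleteResiduatedLattice.Carrier L) : Set ℓ where
  open CompleteResiduatedLattice L
  field
    𝟙*≡𝟙   : (𝟙 *) ≡ 𝟙
    a*≤a   : ∀ a → (a *) ≤ a
    →*≤    : ∀ a b → ((a ⇒ b) *) ≤ ((a *) ⇒ (b *))
    a**≡a* : ∀ a → ((a *) *) ≡ (a *)

module SConstruction {ℓ} (L : CompleteResiduatedLattice ℓ)
         (_* : CompleteResiduatedLattice.Carrier L →
               CompleteResiduatedLattice.Carrier L) where
  open CompleteResiduatedLattice L

  record SElt : Set ℓ where
    constructor mkS
    field
      f     : Carrier → Carrier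
      h     : Carrier → Carrier
      a     : Carrier
      f-def : ∀ x → f x ≡ ((a *) ⊗ x)
      h-def : ∀ x → h x ≡ ((a *) ⇒ x)
  open SElt public

  gc : Carrier → SElt
  gc c = mkS (λ x → (c *) ⊗ x) (λ x → (c *) ⇒ x) c (λ _ → refl) (λ _ → refl)

  _≈S_ : Rel SElt ℓ
  p ≈S q = ∀ x → (f p x ≡ f q x) × (h p x ≡ h q x)

  _⩽_ : Rel SElt ℓ
  p ⩽ q = ∀ x → f p x ≤ f q x

  ResSet : SElt → SElt → SElt → Set ℓ
  ResSet p q w = ∃ λ c → (w ≈S gc c) × (((a p *) ⊗ (c *)) ≤ (a q *))

  IsComposite : SElt → SElt → SElt → Set ℓ
  IsComposite p q r = ∀ x → (f r x ≡ f p (f q x)) × (h r x ≡ h q (h p x))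

  IsBottomGC : SElt → Set ℓ
  IsBottomGC r = ∀ x → (f r x ≡ 𝟘) × (h r x ≡ 𝟙)

  IsIdGC : SElt → Set ℓ
  IsIdGC r = ∀ x → (f r x ≡ x) × (h r x ≡ x)

-- Every ⟨f_c, h_c⟩ ∈ S is determined by the scalar c = a* = f_c(1), and c ↦ ⟨f_c, h_c⟩ is an
-- order-isomorphism from the fixed points {c ; c* = c} of the hedge onto S, sending ⊗ to
-- composition. The fixed points contain 0 and 1 and are closed under ⊗ (since
-- a* ⊗ b* ≤ (a ⊗ b)* for a hedge) and under arbitrary suprema, and a* ⊗ c* ≤ b* holds
-- iff c* ≤ (a* → b*)*. So they form a complete residuated lattice with residuum
-- (a → b)*, and this structure transports to S.
module Submission where

open import Defs
open import Data.Product using (Σ; _×_; _,_; proj₁; proj₂)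
open import Relation.Binary.PropositionalEquality
  using (_≡_; refl; sym; trans; cong; cong₂; subst; subst₂; module ≡-Reasoning)
open import Relation.Binary.Structures using (IsPartialOrder; IsEquivalence)
open import Algebra.Structures using (IsCommutativeMonoid)

module ResiduatedLatticeProperties {ℓ} (L : CompleteResiduatedLattice ℓ) where
  open CompleteResiduatedLattice L

  module PO = IsPartialOrder isPartialOrder
  module CM = IsCommutativeMonoid isCommutativeMonoid

  ≤-refl : ∀ {x} → x ≤ x
  ≤-refl = PO.reflexive refl

  ⊗-monoʳ-≤ : ∀ x {y y′} → y ≤ y′ → (x ⊗ y) ≤ (x ⊗ y′)
  ⊗-monoʳ-≤ x {y} {y′} y≤y′ =
    residuation₂ x y _ (PO.trans y≤y′ (residuation₁ x y′ _ ≤-refl))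

  ⊗-monoˡ-≤ : ∀ x {y y′} → y ≤ y′ → (y ⊗ x) ≤ (y′ ⊗ x)
  ⊗-monoˡ-≤ x {y} {y′} y≤y′ = subst₂ _≤_ (CM.comm x y) (CM.comm x y′) (⊗-monoʳ-≤ x y≤y′)

  ⊗-⇒-≤ : ∀ x y → (x ⊗ (x ⇒ y)) ≤ y
  ⊗-⇒-≤ x y = residuation₂ x _ y ≤-refl

  ⊗-≤ʳ : ∀ x y → (x ⊗ y) ≤ y
  ⊗-≤ʳ x y = subst ((x ⊗ y) ≤_) (CM.identityˡ y) (⊗-monoˡ-≤ y (𝟙-greatest x))

  ⇒-curry : ∀ x y z → ((x ⊗ y) ⇒ z) ≡ (y ⇒ (x ⇒ z))
  ⇒-curry x y z = PO.antisym
    (residuation₁ y _ _ (residuation₁ x _ _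
      (subst (_≤ z) (CM.assoc x y _) (⊗-⇒-≤ (x ⊗ y) z))))
    (residuation₁ (x ⊗ y) _ _ (subst (_≤ z) (sym (CM.assoc x y _))
      (PO.trans (⊗-monoʳ-≤ x (⊗-⇒-≤ y (x ⇒ z))) (⊗-⇒-≤ x z))))

  ≤⇒⇒≡𝟙 : ∀ {x y} → x ≤ y → (x ⇒ y) ≡ 𝟙
  ≤⇒⇒≡𝟙 {x} x≤y = PO.antisym (𝟙-greatest _)
    (residuation₁ x 𝟙 _ (subst (_≤ _) (sym (CM.identityʳ x)) x≤y))

  𝟘⇒≡𝟙 : ∀ x → (𝟘 ⇒ x) ≡ 𝟙
  𝟘⇒≡𝟙 x = ≤⇒⇒≡𝟙 (𝟘-least x)

  𝟘-zeroˡ : ∀ x → (𝟘 ⊗ x) ≡ 𝟘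
  𝟘-zeroˡ x = PO.antisym
    (residuation₂ 𝟘 x 𝟘 (subst (x ≤_) (sym (𝟘⇒≡𝟙 𝟘)) (𝟙-greatest x)))
    (𝟘-least _)

  𝟙⇒-identity : ∀ x → (𝟙 ⇒ x) ≡ x
  𝟙⇒-identity x = PO.antisym
    (subst (_≤ x) (CM.identityˡ _) (⊗-⇒-≤ 𝟙 x))
    (residuation₁ 𝟙 x x (subst (_≤ x) (sym (CM.identityˡ x)) ≤-refl))

module HedgeProperties {ℓ} (L : CompleteResiduatedLattice ℓ)
    (_* : CompleteResiduatedLattice.Carrier L → CompleteResiduatedLattice.Carrier L)
    (hedge : IsHedge L _*) where
  open CompleteResiduatedLattice L
  open IsHedge hedge
  open ResiduatedLatticeProperties L

  Fixed : Carrier → Set ℓ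
  Fixed c = (c *) ≡ c

  *-fixed : ∀ a → Fixed (a *)
  *-fixed = a**≡a*

  𝟘-fixed : Fixed 𝟘
  𝟘-fixed = PO.antisym (a*≤a 𝟘) (𝟘-least _)

  *-mono-≤ : ∀ {x y} → x ≤ y → (x *) ≤ (y *)
  *-mono-≤ {x} {y} x≤y =
    subst (_≤ (y *)) (CM.identityʳ (x *)) (residuation₂ (x *) 𝟙 (y *) 𝟙≤x*⇒y*)
    where
    𝟙≤x*⇒y* : 𝟙 ≤ ((x *) ⇒ (y *))
    𝟙≤x*⇒y* = subst (_≤ _) (trans (cong _* (≤⇒⇒≡𝟙 x≤y)) 𝟙*≡𝟙) (→*≤ x y)

  fixed-≤-* : ∀ {c x} → Fixed c → c ≤ x → c ≤ (x *)
  fixed-≤-* c-fixed c≤x = subst (_≤ _) c-fixed (*-mono-≤ c≤x)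

  *-⊗-≤ : ∀ a b → ((a *) ⊗ (b *)) ≤ ((a ⊗ b) *)
  *-⊗-≤ a b = subst (_≤ ((a ⊗ b) *)) (CM.comm (b *) (a *))
    (residuation₂ (b *) (a *) _ (PO.trans (*-mono-≤ a≤b⇒a⊗b) (→*≤ b (a ⊗ b))))
    where
    a≤b⇒a⊗b : a ≤ (b ⇒ (a ⊗ b))
    a≤b⇒a⊗b = residuation₁ b a _ (subst (_≤ (a ⊗ b)) (CM.comm a b) ≤-refl)

  ⊗-fixed : ∀ {a b} → Fixed a → Fixed b → Fixed (a ⊗ b)
  ⊗-fixed {a} {b} a-fixed b-fixed = PO.antisym (a*≤a _)
    (subst₂ (λ u v → (u ⊗ v) ≤ ((a ⊗ b) *)) a-fixed b-fixed (*-⊗-≤ a b))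

  ⋁-fixed : ∀ P → (∀ x → P x → Fixed x) → Fixed (⋁ P)
  ⋁-fixed P all-fixed = PO.antisym (a*≤a _)
    (proj₂ (⋁-isLub P) _ λ x Px → fixed-≤-* (all-fixed x Px) (proj₁ (⋁-isLub P) x Px))

  fixed-residuation : ∀ {a b c} → Fixed c → (a ⊗ c) ≤ b → c ≤ ((a ⇒ b) *)
  fixed-residuation c-fixed a⊗c≤b = fixed-≤-* c-fixed (residuation₁ _ _ _ a⊗c≤b)

module SProperties {ℓ} (L : CompleteResiduatedLattice ℓ)
    (_* : CompleteResiduatedLattice.Carrier L → CompleteResiduatedLattice.Carrier L)
    (hedge : IsHedge L _*) where
  open CompleteResiduatedLattice L
  open IsHedge hedge
  open ResiduatedLatticeProperties L
  open HedgeProperties L _* hedge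
  open SConstruction L _*
  open ≡-Reasoning

  scalar : SElt → Carrier
  scalar p = a p *

  scalar-fixed : ∀ p → Fixed (scalar p)
  scalar-fixed p = *-fixed (a p)

  f-𝟙 : ∀ p → f p 𝟙 ≡ scalar p
  f-𝟙 p = trans (f-def p 𝟙) (CM.identityʳ _)

  ⩽⇒scalar-≤ : ∀ {p q} → p ⩽ q → scalar p ≤ scalar q
  ⩽⇒scalar-≤ {p} {q} p⩽q = subst₂ _≤_ (f-𝟙 p) (f-𝟙 q) (p⩽q 𝟙)

  scalar-≤⇒⩽ : ∀ {p q} → scalar p ≤ scalar q → p ⩽ q
  scalar-≤⇒⩽ {p} {q} p≤q x = subst₂ _≤_ (sym (f-def p x)) (sym (f-def q x)) (⊗-monoˡ-≤ x p≤q)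

  ≈S⇒scalar-≡ : ∀ {p q} → p ≈S q → scalar p ≡ scalar q
  ≈S⇒scalar-≡ {p} {q} p≈q = trans (sym (f-𝟙 p)) (trans (proj₁ (p≈q 𝟙)) (f-𝟙 q))

  scalar-≡⇒≈S : ∀ {p q} → scalar p ≡ scalar q → p ≈S q
  scalar-≡⇒≈S {p} {q} p≡q x =
    trans (f-def p x) (trans (cong (_⊗ x) p≡q) (sym (f-def q x))) ,
    trans (h-def p x) (trans (cong (_⇒ x) p≡q) (sym (h-def q x)))

  _∘S_ : SElt → SElt → SElt
  p ∘S q = mkS (λ x → f p (f q x)) (λ x → h q (h p x)) (scalar p ⊗ scalar q) f∘f-def h∘h-def
    where
    pq-fixed : Fixed (scalar p ⊗ scalar q)
    pq-fixed = ⊗-fixed (scalar-fixed p) (scalar-fixed q)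

    f∘f-def : ∀ x → f p (f q x) ≡ (((scalar p ⊗ scalar q) *) ⊗ x)
    f∘f-def x = begin
      f p (f q x)                      ≡⟨ f-def p _ ⟩
      scalar p ⊗ f q x                 ≡⟨ cong (scalar p ⊗_) (f-def q x) ⟩
      scalar p ⊗ (scalar q ⊗ x)        ≡⟨ sym (CM.assoc _ _ _) ⟩
      (scalar p ⊗ scalar q) ⊗ x        ≡⟨ cong (_⊗ x) (sym pq-fixed) ⟩
      ((scalar p ⊗ scalar q) *) ⊗ x    ∎

    h∘h-def : ∀ x → h q (h p x) ≡ (((scalar p ⊗ scalar q) *) ⇒ x)
    h∘h-def x = begin
      h q (h p x)                      ≡⟨ h-def q _ ⟩
      scalar q ⇒ h p x                 ≡⟨ cong (scalar q ⇒_) (h-def p x) ⟩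
      scalar q ⇒ (scalar p ⇒ x)        ≡⟨ sym (⇒-curry _ _ _) ⟩
      (scalar p ⊗ scalar q) ⇒ x        ≡⟨ cong (_⇒ x) (sym pq-fixed) ⟩
      ((scalar p ⊗ scalar q) *) ⇒ x    ∎

  scalar-∘S : ∀ p q → scalar (p ∘S q) ≡ scalar p ⊗ scalar q
  scalar-∘S p q = ⊗-fixed (scalar-fixed p) (scalar-fixed q)

  ∘S-isComposite : ∀ p q → IsComposite p q (p ∘S q)
  ∘S-isComposite p q x = refl , refl

  ⊥S : SElt
  ⊥S = mkS (λ _ → 𝟘) (λ _ → 𝟙) 𝟘
    (λ x → sym (trans (cong (_⊗ x) 𝟘-fixed) (𝟘-zeroˡ x)))
    (λ x → sym (trans (cong (_⇒ x) 𝟘-fixed) (𝟘⇒≡𝟙 x)))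

  ⊥S-isBottomGC : IsBottomGC ⊥S
  ⊥S-isBottomGC x = refl , refl

  idS : SElt
  idS = mkS (λ x → x) (λ x → x) 𝟙
    (λ x → sym (trans (cong (_⊗ x) 𝟙*≡𝟙) (CM.identityˡ x)))
    (λ x → sym (trans (cong (_⇒ x) 𝟙*≡𝟙) (𝟙⇒-identity x)))

  idS-isIdGC : IsIdGC idS
  idS-isIdGC x = refl , refl

  _⇝_ : SElt → SElt → SElt
  p ⇝ q = gc (scalar p ⇒ scalar q)

  ⇝-isLub : ∀ p q → IsLub _⩽_ (ResSet p q) (p ⇝ q)
  ⇝-isLub p q = upper , (λ v bounds → bounds (p ⇝ q) p⇝q∈ResSet)
    where
    upper : ∀ w → ResSet p q w → w ⩽ (p ⇝ q)
    upper w (c , w≈gc , p⊗c≤q) = scalar-≤⇒⩽ {w} {p ⇝ q}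
      (subst (_≤ scalar (p ⇝ q)) (sym (≈S⇒scalar-≡ {w} {gc c} w≈gc)) (fixed-residuation (*-fixed c) p⊗c≤q))

    p⇝q∈ResSet : ResSet p q (p ⇝ q)
    p⇝q∈ResSet = (scalar p ⇒ scalar q) , (λ x → refl , refl) ,
      PO.trans (⊗-monoʳ-≤ (scalar p) (a*≤a _)) (⊗-⇒-≤ (scalar p) (scalar q))

  ScalarsOf : (SElt → Set ℓ) → Carrier → Set ℓ
  ScalarsOf Q x = Σ SElt λ p → Q p × (x ≡ scalar p)

  ⋁S : (SElt → Set ℓ) → SElt
  ⋁S Q = gc (⋁ (ScalarsOf Q))

  ⋁S-isLub : ∀ Q → IsLub _⩽_ Q (⋁S Q)
  ⋁S-isLub Q = upper , least
    where
    ⋁-scalars-fixed : Fixed (⋁ (ScalarsOf Q))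
    ⋁-scalars-fixed = ⋁-fixed _ λ { x (p , _ , refl) → scalar-fixed p }

    upper : ∀ p → Q p → p ⩽ ⋁S Q
    upper p Qp = scalar-≤⇒⩽ {p} {⋁S Q} (subst (scalar p ≤_) (sym ⋁-scalars-fixed)
      (proj₁ (⋁-isLub _) (scalar p) (p , Qp , refl)))

    least : ∀ v → (∀ p → Q p → p ⩽ v) → ⋁S Q ⩽ v
    least v bounds = scalar-≤⇒⩽ {⋁S Q} {v} (subst (_≤ scalar v) (sym ⋁-scalars-fixed)
      (proj₂ (⋁-isLub _) (scalar v) λ { x (p , Qp , refl) → ⩽⇒scalar-≤ {p} {v} (bounds p Qp) }))

  ≈S-isEquivalence : IsEquivalence _≈S_
  ≈S-isEquivalence = record
    { refl  = λ x → refl , refl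
    ; sym   = λ p≈q x → sym (proj₁ (p≈q x)) , sym (proj₂ (p≈q x))
    ; trans = λ p≈q q≈r x → trans (proj₁ (p≈q x)) (proj₁ (q≈r x)) , trans (proj₂ (p≈q x)) (proj₂ (q≈r x))
    }

  ⩽-isPartialOrder : IsPartialOrder _≈S_ _⩽_
  ⩽-isPartialOrder = record
    { isPreorder = record
      { isEquivalence = ≈S-isEquivalence
      ; reflexive     = λ p≈q x → PO.reflexive (proj₁ (p≈q x))
      ; trans         = λ p⩽q q⩽r x → PO.trans (p⩽q x) (q⩽r x)
      }
    ; antisym = λ {p} {q} p⩽q q⩽p →
        scalar-≡⇒≈S {p} {q} (PO.antisym (⩽⇒scalar-≤ {p} {q} p⩽q) (⩽⇒scalar-≤ {q} {p} q⩽p))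
    }

  ∘S-isCommutativeMonoid : IsCommutativeMonoid _≈S_ _∘S_ idS
  ∘S-isCommutativeMonoid = record
    { isMonoid = record
      { isSemigroup = record
        { isMagma = record
          { isEquivalence = ≈S-isEquivalence
          ; ∙-cong = λ {p} {p′} {q} {q′} p≈p′ q≈q′ → scalar-≡⇒≈S {p ∘S q} {p′ ∘S q′} (begin
              scalar (p ∘S q)        ≡⟨ scalar-∘S p q ⟩
              scalar p ⊗ scalar q    ≡⟨ cong₂ _⊗_ (≈S⇒scalar-≡ {p} {p′} p≈p′) (≈S⇒scalar-≡ {q} {q′} q≈q′) ⟩
              scalar p′ ⊗ scalar q′  ≡⟨ sym (scalar-∘S p′ q′) ⟩
              scalar (p′ ∘S q′)      ∎)
          }
        ; assoc = λ p q r → scalar-≡⇒≈S {(p ∘S q) ∘S r} {p ∘S (q ∘S r)} (begin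
            scalar ((p ∘S q) ∘S r)             ≡⟨ scalar-∘S (p ∘S q) r ⟩
            scalar (p ∘S q) ⊗ scalar r         ≡⟨ cong (_⊗ scalar r) (scalar-∘S p q) ⟩
            (scalar p ⊗ scalar q) ⊗ scalar r   ≡⟨ CM.assoc _ _ _ ⟩
            scalar p ⊗ (scalar q ⊗ scalar r)   ≡⟨ cong (scalar p ⊗_) (sym (scalar-∘S q r)) ⟩
            scalar p ⊗ scalar (q ∘S r)         ≡⟨ sym (scalar-∘S p (q ∘S r)) ⟩
            scalar (p ∘S (q ∘S r))             ∎)
        }
      ; identity =
          (λ p → scalar-≡⇒≈S {idS ∘S p} {p}
            (trans (scalar-∘S idS p) (trans (cong (_⊗ scalar p) 𝟙*≡𝟙) (CM.identityˡ _))))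
        , (λ p → scalar-≡⇒≈S {p ∘S idS} {p}
            (trans (scalar-∘S p idS) (trans (cong (scalar p ⊗_) 𝟙*≡𝟙) (CM.identityʳ _))))
      }
    ; comm = λ p q → scalar-≡⇒≈S {p ∘S q} {q ∘S p} (begin
        scalar (p ∘S q)      ≡⟨ scalar-∘S p q ⟩
        scalar p ⊗ scalar q  ≡⟨ CM.comm _ _ ⟩
        scalar q ⊗ scalar p  ≡⟨ sym (scalar-∘S q p) ⟩
        scalar (q ∘S p)      ∎)
    }

  ∘S-residuation₁ : ∀ p q r → (p ∘S q) ⩽ r → q ⩽ (p ⇝ r)
  ∘S-residuation₁ p q r pq⩽r = scalar-≤⇒⩽ {q} {p ⇝ r} (fixed-residuation (scalar-fixed q)
    (subst (_≤ scalar r) (scalar-∘S p q) (⩽⇒scalar-≤ {p ∘S q} {r} pq⩽r)))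

  ∘S-residuation₂ : ∀ p q r → q ⩽ (p ⇝ r) → (p ∘S q) ⩽ r
  ∘S-residuation₂ p q r q⩽p⇝r = scalar-≤⇒⩽ {p ∘S q} {r} (subst (_≤ scalar r) (sym (scalar-∘S p q))
    (residuation₂ _ _ _ (PO.trans (⩽⇒scalar-≤ {q} {p ⇝ r} q⩽p⇝r) (a*≤a _))))

  S-isCompleteResiduatedLattice : IsCompleteResiduatedLattice _≈S_ _⩽_ _∘S_ _⇝_ ⊥S idS
  S-isCompleteResiduatedLattice = record
    { isPartialOrder      = ⩽-isPartialOrder
    ; ⋁                   = ⋁S
    ; ⋁-isLub             = ⋁S-isLub
    ; 𝟘-least             = λ p x → 𝟘-least _
    ; 𝟙-greatest          = λ p x → subst (_≤ x) (sym (f-def p x)) (⊗-≤ʳ _ x)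
    ; isCommutativeMonoid = ∘S-isCommutativeMonoid
    ; residuation₁        = ∘S-residuation₁
    ; residuation₂        = ∘S-residuation₂
    }

theorem47 : ∀ {ℓ} (L : CompleteResiduatedLattice ℓ)
              (_* : CompleteResiduatedLattice.Carrier L → CompleteResiduatedLattice.Carrier L) →
              IsHedge L _* →
              let open SConstruction L _* in
              Σ (SElt → SElt → SElt) λ _∘S_ →
              Σ (SElt → SElt → SElt) λ _⇝_ →
              Σ SElt λ ⊥S →
              Σ SElt λ idS →
              (∀ p q → IsComposite p q (p ∘S q)) ×
              (∀ p q → IsLub _⩽_ (ResSet p q) (p ⇝ q)) ×
              IsBottomGC ⊥S ×
              IsIdGC idS ×
              IsCompleteResiduatedLattice _≈S_ _⩽_ _∘S_ _⇝_ ⊥S idS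
theorem47 L _* hedge =
  _∘S_ , _⇝_ , ⊥S , idS ,
  ∘S-isComposite , ⇝-isLub , ⊥S-isBottomGC , idS-isIdGC , S-isCompleteResiduatedLattice
  where open SProperties L _* hedge
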